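{- Let $n=p^\ell m$, where $p$ is a prime and $\ell\geq 1$, $m\geq 2$ are integers. Let $\mathrm{Cay}(\mathbb{Z}_n,S)$ be a connected circulant graph of order $n$ and degree $p^\ell - 1$ such that $S_0$ is pyramidal. Then every admissible subgroup series $H_0<H_1<\cdots<H_{2t-1} \le H_{2t} = \mathbb{Z}_n$ ($t\ge1$) of $\mathbb{Z}_n$ associated with $S_0$ determines two sequences of positive integers $(\ell_1, \ldots, \ell_{t})$ and $(m_1, \ldots, m_{t})$ such that: (a) $\prod_{i=1}^t m_i$ divides $m$; (b) $\sum_{i=1}^t \ell_i = \ell$ if $S_0$ is aperiodic, and $\sum_{i=1}^t \ell_i < \ell$ if $S_0$ is periodic; (c) $|H_{2i}/H_{2i-1}|=p^{\ell_i}$ and $|H_{2i-1}/H_{2i-2}|=m_i$ for $1 \leq i \leq t$; (d) $\mathrm{Cay}(\mathbb{Z}_n/H_{2t-1}, (S_0/H_{2t-1})\setminus \{H_{2t-1}\}) \cong K_{p^{\ell_t}}$.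
   Context: $\mathrm{Cay}(\mathbb{Z}_n,S)$ ($S=-S\subseteq\mathbb{Z}_n\setminus\{0\}$) has $x\sim y$ iff $x-y\in S$; $S_0=S\cup\{0\}$; $K_q$ is the complete graph on $q$ vertices. For a subgroup $H$ and $X\subseteq G$, $X/H=\{x+H:x\in X\}$. A nonzero $a$ with $X+a=X$ is a period; periods with $0$ form the subgroup of periods; $X$ is periodic if it is nontrivial, aperiodic otherwise, and $K$-periodic if $K$ (nontrivial) is its subgroup of periods. Pyramidal set: $X\subseteq G$ ($G$ abelian) with $0\in X$ is pyramidal if there is a series $H_0<H_1<\cdots<H_{2t-1}\le H_{2t}=G$, $t\ge1$, such that either (a) $H_0=\{0\}$, $X$ aperiodic, and (T1) $(X/H_{2i}-X/H_{2i})\cap(H_{2i+1}/H_{2i})=\{0\}$ for $0\le i\le t-1$; (T2) $X/H_{2i-1}$ is $(H_{2i}/H_{2i-1})$-periodic for $1\le i\le t$; (T3) $|X/H_{2t-1}|=|G/H_{2t-1}|$ and $|X/H_{2i}|=|X/H_{2i+1}|$ for $0\le i\le t-1$; or (b) $H_0\ne\{0\}$, $X$ is $H_0$-periodic and $X/H_0$ satisfies (T1)–(T3) in $G/H_0$ with respect to the series $H_i/H_0$. Such a series is an admissible subgroup series associated with $X$. -}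

module Defs where

open import Data.Nat using (ℕ; zero; suc; _+_; _*_; _∸_; _≤_; _<_; _≤?_)
open import Data.Nat.DivMod using (_%_; m%n<n)
open import Data.Fin using (Fin; toℕ; fromℕ<)
open import Data.Fin.Properties using (any?; all?)
open import Data.Fin.Subset using (Subset; _∈_; _∉_; _⊆_; _⊂_; ⊤; ⁅_⁆; _∪_; ∣_∣)
open import Data.Fin.Subset.Properties using (_∈?_)
open import Data.List using (List; length; filter; allFin)
open import Data.Product using (Σ; ∃; _×_; _,_)
open import Data.Sum using (_⊎_)
open import Relation.Nullary using (¬_; Dec)
open import Relation.Nullary.Decidable using (_×-dec_; _→-dec_)
open import Relation.Unary using (Pred; Decidable)
open import Relation.Binary.PropositionalEquality using (_≡_; _≢_)
open import Function.Bundles using (_⇔_)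
import Level

sumTo : (ℕ → ℕ) → ℕ → ℕ
sumTo f zero    = 0
sumTo f (suc t) = sumTo f t + f (suc t)

prodTo : (ℕ → ℕ) → ℕ → ℕ
prodTo f zero    = 1
prodTo f (suc t) = prodTo f t * f (suc t)

module _ {k : ℕ} where

  private
    n : ℕ
    n = suc k

  count : {P : Pred (Fin n) Level.0ℓ} → Decidable P → ℕ
  count P? = length (filter P? (allFin n))

  𝟎 : Fin n
  𝟎 = Fin.zero

  infixl 6 _⊕_ _⊖_
  _⊕_ : Fin n → Fin n → Fin n
  x ⊕ y = fromℕ< (m%n<n (toℕ x + toℕ y) n)

  ⊝_ : Fin n → Fin n
  ⊝ x = fromℕ< (m%n<n (n ∸ toℕ x) n)

  _⊖_ : Fin n → Fin n → Fin n
  x ⊖ y = x ⊕ (⊝ y)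

  IsSubgroup : Subset n → Set
  IsSubgroup H = 𝟎 ∈ H
               × (∀ x y → x ∈ H → y ∈ H → (x ⊕ y) ∈ H)
               × (∀ x → x ∈ H → (⊝ x) ∈ H)

  IsConnectionSet : Subset n → Set
  IsConnectionSet S = 𝟎 ∉ S × (∀ x → x ∈ S → (⊝ x) ∈ S)

  Adj : Subset n → Fin n → Fin n → Set
  Adj S x y = (x ⊖ y) ∈ S

  data Walk (S : Subset n) : Fin n → Fin n → Set where
    here : ∀ {x} → Walk S x x
    step : ∀ {x y z} → Adj S x y → Walk S y z → Walk S x z

  Connected : Subset n → Set
  Connected S = ∀ x y → Walk S x y

  degree : Subset n → Fin n → ℕ
  degree S x = count (λ y → (x ⊖ y) ∈? S)

  S₀ : Subset n → Subset n
  S₀ S = S ∪ ⁅ 𝟎 ⁆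

  Period : Subset n → Fin n → Set
  Period X a = a ≢ 𝟎 × (∀ x → (x ∈ X) ⇔ ((x ⊕ a) ∈ X))

  Aperiodic : Subset n → Set
  Aperiodic X = ∀ a → ¬ Period X a

  Periodic : Subset n → Set
  Periodic X = ∃ λ a → Period X a

  Trivial : Subset n → Set
  Trivial K = ∀ a → a ∈ K → a ≡ 𝟎

  PeriodicWith : Subset n → Subset n → Set
  PeriodicWith K X = ¬ Trivial K × (∀ a → (a ≡ 𝟎 ⊎ Period X a) ⇔ (a ∈ K))

  -- Quotients by a subgroup K.  The coset a + K is represented by any
  -- of its elements; X/K is the set of cosets x + K with x ∈ X.

  InQuot : Subset n → Subset n → Fin n → Set
  InQuot K X a = ∃ λ y → y ∈ X × (a ⊖ y) ∈ K

  CosetRep : Subset n → Fin n → Set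
  CosetRep K a = ∀ b → (b ⊖ a) ∈ K → toℕ a ≤ toℕ b

  cosetRep? : (K X : Subset n) → Decidable (λ a → CosetRep K a × InQuot K X a)
  cosetRep? K X a =
    all? (λ b → ((b ⊖ a) ∈? K) →-dec (toℕ a ≤? toℕ b))
    ×-dec any? (λ y → (y ∈? X) ×-dec ((a ⊖ y) ∈? K))

  -- |X/K| : the number of cosets of K meeting X
  ∣_/_∣ : Subset n → Subset n → ℕ
  ∣ X / K ∣ = count (cosetRep? K X)

  QuotPeriod : Subset n → Subset n → Fin n → Set
  QuotPeriod K X a = a ∉ K × (∀ x → InQuot K X x ⇔ InQuot K X (x ⊕ a))

  -- X/K is (H/K)-periodic in ℤ_n/K  (for K ⊆ H)
  QuotPeriodicWith : Subset n → Subset n → Subset n → Set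
  QuotPeriodicWith K H X =
    (∃ λ a → a ∈ H × a ∉ K)
    × (∀ a → (a ∈ K ⊎ QuotPeriod K X a) ⇔ (a ∈ H))

  Admissible : Subset n → ℕ → (ℕ → Subset n) → Set
  Admissible X t H =
      1 ≤ t
    × (∀ i → i ≤ 2 * t → IsSubgroup (H i))
    × (∀ i → suc i < 2 * t → H i ⊂ H (suc i))
    × H (2 * t ∸ 1) ⊆ H (2 * t)
    × H (2 * t) ≡ ⊤
    × ((Trivial (H 0) × Aperiodic X) ⊎ PeriodicWith (H 0) X)
    -- (T1)  (X/H₂ᵢ - X/H₂ᵢ) ∩ (H₂ᵢ₊₁/H₂ᵢ) = {0}
    × (∀ i → i < t → ∀ x y → x ∈ X → y ∈ X →
         (x ⊖ y) ∈ H (suc (2 * i)) → (x ⊖ y) ∈ H (2 * i))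
    × (∀ i → 1 ≤ i → i ≤ t → QuotPeriodicWith (H (2 * i ∸ 1)) (H (2 * i)) X)
    × ∣ X / H (2 * t ∸ 1) ∣ ≡ ∣ ⊤ / H (2 * t ∸ 1) ∣
    × (∀ i → i < t → ∣ X / H (2 * i) ∣ ≡ ∣ X / H (suc (2 * i)) ∣)

  Pyramidal : Subset n → Set
  Pyramidal X = 𝟎 ∈ X × (∃ λ t → ∃ λ H → Admissible X t H)

  -- Cay(ℤ_n/K, (X/K) ∖ {K}) ≅ K_q : a bijection f between the cosets of K
  -- and Fin q (given as a map constant exactly on cosets, surjective)
  -- carrying adjacency to distinctness.

  QuotAdj : Subset n → Subset n → Fin n → Fin n → Set
  QuotAdj K X a b = InQuot K X (a ⊖ b) × (a ⊖ b) ∉ K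

  QuotCayleyIsoComplete : Subset n → Subset n → ℕ → Set
  QuotCayleyIsoComplete K X q =
    Σ (Fin n → Fin q) λ f →
        (∀ a b → (f a ≡ f b) ⇔ ((a ⊖ b) ∈ K))
      × (∀ j → ∃ λ a → f a ≡ j)
      × (∀ a b → QuotAdj K X a b ⇔ (f a ≢ f b))

{-# OPTIONS --safe #-}
module Submission where

-- Everything is counting in ℤₙ.  For a subgroup K, X + K is the disjoint union of the |X/K|
-- cosets of K that meet X, so |X + K| = |X/K|·|K|.  Hence |H| = |H/K|·|K| for K ≤ H, and if
-- X/K is (H/K)-periodic then X + K = X + H, so |X/K| = |X/H|·|H/K|.  Along an admissible
-- series, (T2) and (T3) make |X/H₀| telescope to ∏ᵢ |H₂ᵢ/H₂ᵢ₋₁|; with X + H₀ = X this gives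
--   p^ℓ = |S₀| = ∏ᵢ |H₂ᵢ/H₂ᵢ₋₁| · |H₀|   and   p^ℓ m = n = ∏ᵢ |H₂ᵢ/H₂ᵢ₋₁| · ∏ᵢ |H₂ᵢ₋₁/H₂ᵢ₋₂| · |H₀|.
-- Hence ∏ mᵢ = m, while |H₂ᵢ/H₂ᵢ₋₁| and |H₀| divide p^ℓ and so are powers of the prime p whose
-- exponents add up to ℓ; |H₀| = p⁰ exactly when S₀ is aperiodic.  Finally (T3) says that S₀
-- meets every coset of H₂ₜ₋₁, so any two distinct cosets are adjacent in the quotient graph.

open import Defs
open import Data.Nat using (ℕ; zero; suc; _+_; _*_; _∸_; _^_; _≤_; _<_; _≤?_; z≤n; s≤s; z<s; NonZero; >-nonZero; nonTrivial⇒n>1)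
open import Data.Nat.DivMod using (_%_; m%n<n; m%n%n≡m%n; %-distribˡ-+; m<n⇒m%n≡m; n%n≡0)
open import Data.Nat.Properties
open import Data.Nat.Divisibility using (_∣_; _∤_; divides; _∣?_; ∣-trans; ∣-reflexive; ∣1⇒≡1; m∣m*n; n∣m*n; *-cancelˡ-∣)
open import Data.Nat.Primality using (Prime; prime⇒nonZero; prime⇒nonTrivial; prime⇒irreducible)
open import Data.Nat.Coprimality using (Coprime; coprime-divisor)
open import Data.Fin using (Fin; zero; suc; toℕ; fromℕ<; inject)
open import Data.Fin.Properties using (toℕ-injective; toℕ<n; toℕ-fromℕ<; toℕ-inject; ¬∀⟶∃¬; ¬∀⟶∃¬-smallest; any?)
  renaming (_≟_ to _≟ᶠ_; suc-injective to suc-injectiveᶠ)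
open import Data.Fin.Permutation using (Permutation; permutation; _⟨$⟩ʳ_)
open import Data.Fin.Subset using (Subset; _∈_; _∉_; _⊆_; _⊂_; ⊤; ⁅_⁆; _∪_)
open import Data.Fin.Subset.Properties using (_∈?_; ∈⊤; x∈⁅x⁆; x∈⁅y⁆⇒x≡y; x∈p∪q⁺; x∈p∪q⁻)
open import Data.List using (List; length; filter; allFin; lookup; tabulate)
open import Data.List.Properties using (filter-all; length-tabulate)
import Data.List.Relation.Unary.All as All
open import Data.List.Relation.Unary.AllPairs using (_∷_)
open import Data.List.Relation.Unary.Any using (index)
open import Data.List.Relation.Unary.Any.Properties using (lookup-index)
open import Data.List.Relation.Unary.Unique.Propositional using (Unique)
import Data.List.Relation.Unary.Unique.Propositional.Properties as Unique
open import Data.List.Membership.Propositional using () renaming (_∈_ to _∈ₗ_)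
open import Data.List.Membership.Propositional.Properties using (∈-filter⁺; ∈-filter⁻; ∈-allFin; ∈-lookup)
open import Data.Product using (Σ; ∃; ∃-syntax; _×_; _,_; proj₁; proj₂)
open import Data.Sum using (_⊎_; inj₁; inj₂; [_,_]′)
open import Function using (_∘_; id; const)
open import Function.Bundles using (_⇔_; mk⇔; Equivalence)
open import Level using (0ℓ)
open import Relation.Binary.Definitions using (tri<; tri≈; tri>)
open import Relation.Binary.PropositionalEquality
open import Relation.Binary.PropositionalEquality.Algebra using (isMagma)
open import Relation.Nullary using (¬_; Dec; yes; no; contradiction)
open import Relation.Nullary.Decidable using (decidable-stable; _×-dec_; _→-dec_)
open import Data.Empty using (⊥-elim)
open import Relation.Unary using (Pred; Decidable; IUniversal; _⇒_; ∁)
open import Relation.Unary.Properties using (∁?)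
open import Algebra.Bundles using (AbelianGroup)
open import Algebra.Consequences.Propositional using (comm∧idʳ⇒id; comm∧invʳ⇒inv)
import Algebra.Properties.AbelianGroup as AbelianGroupProperties
open import Algebra.Properties.CommutativeSemigroup *-commutativeSemigroup using (interchange; xy∙z≈xz∙y)
open import Algebra.Properties.Semiring.Sum +-*-semiring
  using (sum; sum-syntax; sum-cong-≗; sum-replicate-zero; ∑-comm; ∑-permute; ∑-distrib-+; *-distribˡ-sum; *-distribʳ-sum)

open ≡-Reasoning

n<m*n⇒1<m : ∀ m {n} → n < m * n → 1 < m
n<m*n⇒1<m 0             ()
n<m*n⇒1<m 1             {n} n<1*n = contradiction (subst (n <_) (*-identityˡ n) n<1*n) (<-irrefl refl)
n<m*n⇒1<m (suc (suc _)) _       = s≤s (s≤s z≤n)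

1<m^n⇒0<n : ∀ {m} n → 1 < m ^ n → 0 < n
1<m^n⇒0<n zero    (s≤s ())
1<m^n⇒0<n (suc _) _       = z<s

^-injectiveʳ : ∀ {m} → 1 < m → ∀ {i j} → m ^ i ≡ m ^ j → i ≡ j
^-injectiveʳ {m} 1<m {i} {j} m^i≡m^j with <-cmp i j
... | tri< i<j _ _ = contradiction m^i≡m^j (<⇒≢ (^-monoʳ-< m 1<m i<j))
... | tri≈ _ i≡j _ = i≡j
... | tri> _ _ i>j = contradiction m^i≡m^j (>⇒≢ (^-monoʳ-< m 1<m i>j))

[m%n+o]%n≡[m+o]%n : ∀ m o n .{{_ : NonZero n}} → (m % n + o) % n ≡ (m + o) % n
[m%n+o]%n≡[m+o]%n m o n = begin
  (m % n + o) % n          ≡⟨ %-distribˡ-+ (m % n) o n ⟩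
  (m % n % n + o % n) % n  ≡⟨ cong (λ x → (x + o % n) % n) (m%n%n≡m%n m n) ⟩
  (m % n + o % n) % n      ≡⟨ %-distribˡ-+ m o n ⟨
  (m + o) % n              ∎

[m+o%n]%n≡[m+o]%n : ∀ m o n .{{_ : NonZero n}} → (m + o % n) % n ≡ (m + o) % n
[m+o%n]%n≡[m+o]%n m o n = begin
  (m + o % n) % n  ≡⟨ cong (_% n) (+-comm m (o % n)) ⟩
  (o % n + m) % n  ≡⟨ [m%n+o]%n≡[m+o]%n o m n ⟩
  (o + m) % n      ≡⟨ cong (_% n) (+-comm o m) ⟩
  (m + o) % n      ∎

prodTo-cong : ∀ {f g} t → (∀ i → 1 ≤ i → i ≤ t → f i ≡ g i) → prodTo f t ≡ prodTo g t
prodTo-cong zero    _   = refl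
prodTo-cong (suc t) f≗g =
  cong₂ _*_ (prodTo-cong t (λ i 1≤i i≤t → f≗g i 1≤i (m≤n⇒m≤1+n i≤t))) (f≗g (suc t) z<s ≤-refl)

prodTo-distrib-* : ∀ f g t → prodTo (λ i → f i * g i) t ≡ prodTo f t * prodTo g t
prodTo-distrib-* f g zero    = refl
prodTo-distrib-* f g (suc t) = begin
  prodTo (λ i → f i * g i) t * (f (suc t) * g (suc t))  ≡⟨ cong (_* (f (suc t) * g (suc t))) (prodTo-distrib-* f g t) ⟩
  prodTo f t * prodTo g t * (f (suc t) * g (suc t))     ≡⟨ interchange (prodTo f t) (prodTo g t) (f (suc t)) (g (suc t)) ⟩
  prodTo f t * f (suc t) * (prodTo g t * g (suc t))     ∎

prodTo-^ : ∀ m e t → prodTo (λ i → m ^ e i) t ≡ m ^ sumTo e t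
prodTo-^ m e zero    = refl
prodTo-^ m e (suc t) = begin
  prodTo (λ i → m ^ e i) t * m ^ e (suc t)  ≡⟨ cong (_* m ^ e (suc t)) (prodTo-^ m e t) ⟩
  m ^ sumTo e t * m ^ e (suc t)             ≡⟨ ^-distribˡ-+-* m (sumTo e t) (e (suc t)) ⟨
  m ^ sumTo e (suc t)                       ∎

∣prodTo : ∀ f {t i} → 1 ≤ i → i ≤ t → f i ∣ prodTo f t
∣prodTo f {zero}  (s≤s _) ()
∣prodTo f {suc t} 1≤i i≤1+t with m≤n⇒m<n∨m≡n i≤1+t
... | inj₁ i<1+t = ∣-trans (∣prodTo f 1≤i (≤-pred i<1+t)) (m∣m*n (f (suc t)))
... | inj₂ refl  = n∣m*n (prodTo f t)

prodTo-telescope : ∀ (f a : ℕ → ℕ) t → (∀ {j} → j < t → f (suc j) ≡ a (suc j) * f j) →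
                   f t ≡ prodTo a t * f 0
prodTo-telescope f a zero    _          = sym (+-identityʳ (f 0))
prodTo-telescope f a (suc t) recurrence = begin
  f (suc t)                       ≡⟨ recurrence ≤-refl ⟩
  a (suc t) * f t                 ≡⟨ cong (a (suc t) *_) (prodTo-telescope f a t (recurrence ∘ m<n⇒m<1+n)) ⟩
  a (suc t) * (prodTo a t * f 0)  ≡⟨ *-assoc (a (suc t)) _ _ ⟨
  a (suc t) * prodTo a t * f 0    ≡⟨ cong (_* f 0) (*-comm (a (suc t)) _) ⟩
  prodTo a (suc t) * f 0          ∎

prodTo-telescope⁻ : ∀ (f a : ℕ → ℕ) t → (∀ {j} → j < t → f j ≡ f (suc j) * a (suc j)) →
                    f 0 ≡ f t * prodTo a t
prodTo-telescope⁻ f a zero    _          = sym (*-identityʳ (f 0))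
prodTo-telescope⁻ f a (suc t) recurrence = begin
  f 0                                 ≡⟨ prodTo-telescope⁻ f a t (recurrence ∘ m<n⇒m<1+n) ⟩
  f t * prodTo a t                    ≡⟨ cong (_* prodTo a t) (recurrence ≤-refl) ⟩
  f (suc t) * a (suc t) * prodTo a t  ≡⟨ xy∙z≈xz∙y (f (suc t)) _ _ ⟩
  f (suc t) * prodTo a t * a (suc t)  ≡⟨ *-assoc (f (suc t)) _ _ ⟩
  f (suc t) * prodTo a (suc t)        ∎

record PowerFactorisation (p t : ℕ) (a : ℕ → ℕ) (c ℓ : ℕ) : Set where
  field
    ls           : ℕ → ℕ
    e            : ℕ
    a≡p^ls       : ∀ i → 1 ≤ i → i ≤ t → a i ≡ p ^ ls i
    c≡p^e        : c ≡ p ^ e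
    sumTo-ls+e≡ℓ : sumTo ls t + e ≡ ℓ

module _ {p : ℕ} (p-prime : Prime p) where

  private
    instance
      p≢0 : NonZero p
      p≢0 = prime⇒nonZero p-prime

    1<p : 1 < p
    1<p = nonTrivial⇒n>1 p {{prime⇒nonTrivial p-prime}}

    ∤⇒coprime : ∀ {d} → p ∤ d → Coprime d p
    ∤⇒coprime {d} p∤d (c∣d , c∣p) =
      [ id , (λ c≡p → contradiction (subst (_∣ d) c≡p c∣d) p∤d) ]′ (prime⇒irreducible p-prime c∣p)

  ∣p^⇒≡p^ : ∀ e {d} → d ∣ p ^ e → ∃[ j ] d ≡ p ^ j
  ∣p^⇒≡p^ zero    d∣1 = 0 , ∣1⇒≡1 d∣1
  ∣p^⇒≡p^ (suc e) {d} d∣p^1+e with p ∣? d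
  ... | no p∤d = ∣p^⇒≡p^ e (coprime-divisor (∤⇒coprime p∤d) d∣p^1+e)
  ... | yes (divides q refl) =
    let j , q≡p^j = ∣p^⇒≡p^ e (*-cancelˡ-∣ p (subst (_∣ p ^ suc e) (*-comm q p) d∣p^1+e))
    in suc j , trans (*-comm q p) (cong (p *_) q≡p^j)

  prodTo*≡p^⇒powers : ∀ t a c ℓ → prodTo a t * c ≡ p ^ ℓ → PowerFactorisation p t a c ℓ
  prodTo*≡p^⇒powers t a c ℓ ∏a*c≡p^ℓ = record
    { ls = ls ; e = e ; a≡p^ls = a≡p^ls ; c≡p^e = c≡p^e
    ; sumTo-ls+e≡ℓ = ^-injectiveʳ 1<p (begin
      p ^ (sumTo ls t + e)           ≡⟨ ^-distribˡ-+-* p (sumTo ls t) e ⟩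
      p ^ sumTo ls t * p ^ e         ≡⟨ cong₂ _*_ (prodTo-^ p ls t) c≡p^e ⟨
      prodTo (λ i → p ^ ls i) t * c  ≡⟨ cong (_* c) (prodTo-cong t a≡p^ls) ⟨
      prodTo a t * c                 ≡⟨ ∏a*c≡p^ℓ ⟩
      p ^ ℓ                          ∎)
    }
    where
    ls : ℕ → ℕ
    ls i with a i ∣? p ^ ℓ
    ... | yes a∣p^ℓ = proj₁ (∣p^⇒≡p^ ℓ a∣p^ℓ)
    ... | no _      = 0

    ∏a∣p^ℓ : prodTo a t ∣ p ^ ℓ
    ∏a∣p^ℓ = divides c (trans (sym ∏a*c≡p^ℓ) (*-comm (prodTo a t) c))

    a≡p^ls : ∀ i → 1 ≤ i → i ≤ t → a i ≡ p ^ ls i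
    a≡p^ls i 1≤i i≤t with a i ∣? p ^ ℓ
    ... | yes a∣p^ℓ = proj₂ (∣p^⇒≡p^ ℓ a∣p^ℓ)
    ... | no a∤p^ℓ  = contradiction (∣-trans (∣prodTo a 1≤i i≤t) ∏a∣p^ℓ) a∤p^ℓ

    c-power : ∃[ e ] c ≡ p ^ e
    c-power = ∣p^⇒≡p^ ℓ (divides (prodTo a t) (sym ∏a*c≡p^ℓ))

    e : ℕ
    e = proj₁ c-power

    c≡p^e : c ≡ p ^ e
    c≡p^e = proj₂ c-power

𝟙 : {P : Set} → Dec P → ℕ
𝟙 (yes _) = 1
𝟙 (no _)  = 0

𝟙-yes : ∀ {P} (P? : Dec P) → P → 𝟙 P? ≡ 1
𝟙-yes (yes _) _ = refl
𝟙-yes (no ¬p) p = contradiction p ¬p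

𝟙-no : ∀ {P} (P? : Dec P) → ¬ P → 𝟙 P? ≡ 0
𝟙-no (yes p) ¬p = contradiction p ¬p
𝟙-no (no _)  _  = refl

𝟙-mono : ∀ {P Q} (P? : Dec P) (Q? : Dec Q) → (P → Q) → 𝟙 P? ≤ 𝟙 Q?
𝟙-mono (yes p) (yes _) _   = ≤-refl
𝟙-mono (yes p) (no ¬q) P→Q = contradiction (P→Q p) ¬q
𝟙-mono (no _)  _       _   = z≤n

𝟙-cong : ∀ {P Q} (P? : Dec P) (Q? : Dec Q) → (P → Q) → (Q → P) → 𝟙 P? ≡ 𝟙 Q?
𝟙-cong P? Q? P→Q Q→P = ≤-antisym (𝟙-mono P? Q? P→Q) (𝟙-mono Q? P? Q→P)

𝟙-* : ∀ {P Q} (P? : Dec P) (Q? : Dec Q) → 𝟙 P? * 𝟙 Q? ≡ 𝟙 (P? ×-dec Q?)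
𝟙-* (yes _) (yes _) = refl
𝟙-* (yes _) (no _)  = refl
𝟙-* (no _)  _       = refl

sum-mono-≤ : ∀ {m} {f g : Fin m → ℕ} → (∀ i → f i ≤ g i) → sum f ≤ sum g
sum-mono-≤ {zero}  _   = z≤n
sum-mono-≤ {suc m} f≤g = +-mono-≤ (f≤g zero) (sum-mono-≤ (f≤g ∘ suc))

sum-mono-< : ∀ {m} {f g : Fin m → ℕ} → (∀ i → f i ≤ g i) → ∀ j → f j < g j → sum f < sum g
sum-mono-< f≤g zero    f<g = +-mono-<-≤ f<g (sum-mono-≤ (f≤g ∘ suc))
sum-mono-< f≤g (suc j) f<g = +-mono-≤-< (f≤g zero) (sum-mono-< (f≤g ∘ suc) j f<g)

≤-sum : ∀ {m} (f : Fin m → ℕ) j → f j ≤ sum f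
≤-sum f zero    = m≤m+n _ _
≤-sum f (suc j) = ≤-trans (≤-sum (f ∘ suc) j) (m≤n+m _ _)

sum-supported-at : ∀ {m} (f : Fin m → ℕ) j → (∀ i → i ≢ j → f i ≡ 0) → sum f ≡ f j
sum-supported-at {suc m} f zero    f≡0 = begin
  f zero + sum (f ∘ suc)  ≡⟨ cong (f zero +_) (trans (sum-cong-≗ (λ i → f≡0 (suc i) λ ())) (sum-replicate-zero m)) ⟩
  f zero + 0              ≡⟨ +-identityʳ (f zero) ⟩
  f zero                  ∎
sum-supported-at f (suc j) f≡0 =
  trans (cong (_+ sum (f ∘ suc)) (f≡0 zero λ ()))
        (sum-supported-at (f ∘ suc) j (λ i i≢j → f≡0 (suc i) (i≢j ∘ suc-injectiveᶠ)))

length-filter-tabulate : ∀ {a} {A : Set a} {P : Pred A 0ℓ} (P? : Decidable P) {m} (f : Fin m → A) →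
                         length (filter P? (tabulate f)) ≡ ∑[ i < m ] 𝟙 (P? (f i))
length-filter-tabulate P? {zero}  f = refl
length-filter-tabulate P? {suc m} f with P? (f zero)
... | yes _ = cong suc (length-filter-tabulate P? (f ∘ suc))
... | no _  = length-filter-tabulate P? (f ∘ suc)

lookup-injective : ∀ {a} {A : Set a} {xs : List A} → Unique xs → ∀ {i j} → lookup xs i ≡ lookup xs j → i ≡ j
lookup-injective (_     ∷ _)     {zero}  {zero}  _  = refl
lookup-injective (x∉xs ∷ _)     {zero}  {suc j} eq = contradiction eq (All.lookup x∉xs (∈-lookup j))
lookup-injective (x∉xs ∷ _)     {suc i} {zero}  eq = contradiction (sym eq) (All.lookup x∉xs (∈-lookup i))
lookup-injective (_     ∷ uniq) {suc i} {suc j} eq = cong suc (lookup-injective uniq eq)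

least : ∀ {n p} {P : Pred (Fin n) p} → Decidable P → ∀ {a} → P a →
        ∃[ r ] P r × (∀ b → P b → toℕ r ≤ toℕ b)
least {n} {P = P} P? {a} Pa with ¬∀⟶∃¬-smallest n (∁ P) (∁? P?) (λ ∀¬P → ∀¬P a Pa)
... | r , ¬¬Pr , below-r = r , decidable-stable (P? r) ¬¬Pr , minimal
  where
  minimal : ∀ b → P b → toℕ r ≤ toℕ b
  minimal b Pb with toℕ r ≤? toℕ b
  ... | yes r≤b = r≤b
  ... | no r≰b  = contradiction (subst P (sym inject-b≡b) Pb) (below-r (fromℕ< b<r))
    where
    b<r : toℕ b < toℕ r
    b<r = ≰⇒> r≰b

    inject-b≡b : inject (fromℕ< b<r) ≡ b
    inject-b≡b = toℕ-injective (trans (toℕ-inject (fromℕ< b<r)) (toℕ-fromℕ< b<r))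

-- The group ℤₙ and its subsets

module _ {k : ℕ} where

  private
    n : ℕ
    n = suc k

  toℕ-⊕ : ∀ (x y : Fin n) → toℕ (x ⊕ y) ≡ (toℕ x + toℕ y) % n
  toℕ-⊕ x y = toℕ-fromℕ< (m%n<n (toℕ x + toℕ y) n)

  ⊕-comm : ∀ (x y : Fin n) → x ⊕ y ≡ y ⊕ x
  ⊕-comm x y = toℕ-injective (begin
    toℕ (x ⊕ y)          ≡⟨ toℕ-⊕ x y ⟩
    (toℕ x + toℕ y) % n  ≡⟨ cong (_% n) (+-comm (toℕ x) (toℕ y)) ⟩
    (toℕ y + toℕ x) % n  ≡⟨ toℕ-⊕ y x ⟨
    toℕ (y ⊕ x)          ∎)

  ⊕-assoc : ∀ (x y z : Fin n) → (x ⊕ y) ⊕ z ≡ x ⊕ (y ⊕ z)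
  ⊕-assoc x y z = toℕ-injective (begin
    toℕ ((x ⊕ y) ⊕ z)                  ≡⟨ toℕ-⊕ (x ⊕ y) z ⟩
    (toℕ (x ⊕ y) + toℕ z) % n          ≡⟨ cong (λ w → (w + toℕ z) % n) (toℕ-⊕ x y) ⟩
    ((toℕ x + toℕ y) % n + toℕ z) % n  ≡⟨ [m%n+o]%n≡[m+o]%n (toℕ x + toℕ y) (toℕ z) n ⟩
    (toℕ x + toℕ y + toℕ z) % n        ≡⟨ cong (_% n) (+-assoc (toℕ x) (toℕ y) (toℕ z)) ⟩
    (toℕ x + (toℕ y + toℕ z)) % n      ≡⟨ [m+o%n]%n≡[m+o]%n (toℕ x) (toℕ y + toℕ z) n ⟨
    (toℕ x + (toℕ y + toℕ z) % n) % n  ≡⟨ cong (λ w → (toℕ x + w) % n) (toℕ-⊕ y z) ⟨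
    (toℕ x + toℕ (y ⊕ z)) % n          ≡⟨ toℕ-⊕ x (y ⊕ z) ⟨
    toℕ (x ⊕ (y ⊕ z))                  ∎)

  ⊕-identityʳ : ∀ (x : Fin n) → x ⊕ 𝟎 ≡ x
  ⊕-identityʳ x = toℕ-injective (begin
    toℕ (x ⊕ 𝟎)      ≡⟨ toℕ-⊕ x 𝟎 ⟩
    (toℕ x + 0) % n  ≡⟨ cong (_% n) (+-identityʳ (toℕ x)) ⟩
    toℕ x % n        ≡⟨ m<n⇒m%n≡m (toℕ<n x) ⟩
    toℕ x            ∎)

  ⊕-inverseʳ : ∀ (x : Fin n) → x ⊕ (⊝ x) ≡ 𝟎
  ⊕-inverseʳ x = toℕ-injective (begin
    toℕ (x ⊕ (⊝ x))                ≡⟨ toℕ-⊕ x (⊝ x) ⟩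
    (toℕ x + toℕ (⊝ x)) % n        ≡⟨ cong (λ w → (toℕ x + w) % n) (toℕ-fromℕ< (m%n<n (n ∸ toℕ x) n)) ⟩
    (toℕ x + (n ∸ toℕ x) % n) % n  ≡⟨ [m+o%n]%n≡[m+o]%n (toℕ x) (n ∸ toℕ x) n ⟩
    (toℕ x + (n ∸ toℕ x)) % n      ≡⟨ cong (_% n) (m+[n∸m]≡n (<⇒≤ (toℕ<n x))) ⟩
    n % n                          ≡⟨ n%n≡0 n ⟩
    0                              ∎)

  ℤₙ : AbelianGroup 0ℓ 0ℓ
  ℤₙ = record
    { Carrier        = Fin n
    ; _≈_            = _≡_
    ; _∙_            = _⊕_
    ; ε              = 𝟎
    ; _⁻¹            = ⊝_
    ; isAbelianGroup = record
      { isGroup = record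
        { isMonoid = record
          { isSemigroup = record { isMagma = isMagma _⊕_ ; assoc = ⊕-assoc }
          ; identity    = comm∧idʳ⇒id ⊕-comm ⊕-identityʳ
          }
        ; inverse = comm∧invʳ⇒inv ⊕-comm ⊕-inverseʳ
        ; ⁻¹-cong = cong ⊝_
        }
      ; comm = ⊕-comm
      }
    }

  open AbelianGroupProperties ℤₙ using (//-rightDividesˡ; //-rightDividesʳ; x∙y⁻¹≈ε⇒x≈y; ⁻¹-anti-homo‿-)

  ⊖-telescope : ∀ (a b c : Fin n) → (a ⊖ b) ⊕ (b ⊖ c) ≡ a ⊖ c
  ⊖-telescope a b c = begin
    (a ⊖ b) ⊕ (b ⊕ (⊝ c))  ≡⟨ ⊕-assoc (a ⊖ b) b (⊝ c) ⟨
    ((a ⊖ b) ⊕ b) ⊕ (⊝ c)  ≡⟨ cong (_⊖ c) (//-rightDividesˡ b a) ⟩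
    a ⊖ c                  ∎

  x⊕[y⊖x]≡y : ∀ (x y : Fin n) → x ⊕ (y ⊖ x) ≡ y
  x⊕[y⊖x]≡y x y = trans (⊕-comm x (y ⊖ x)) (//-rightDividesˡ x y)

  x⊖[x⊖y]≡y : ∀ (x y : Fin n) → x ⊖ (x ⊖ y) ≡ y
  x⊖[x⊖y]≡y x y = trans (cong (x ⊕_) (⁻¹-anti-homo‿- x y)) (x⊕[y⊖x]≡y x y)

  translation : Fin n → Permutation n n
  translation r = permutation (_⊖ r) (_⊕ r) (//-rightDividesʳ r) (//-rightDividesˡ r)

  reflection : Fin n → Permutation n n
  reflection x = permutation (x ⊖_) (x ⊖_) (x⊖[x⊖y]≡y x) (x⊖[x⊖y]≡y x)

  count≡∑𝟙 : ∀ {P : Pred (Fin n) 0ℓ} (P? : Decidable P) → count P? ≡ ∑[ a < n ] 𝟙 (P? a)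
  count≡∑𝟙 P? = length-filter-tabulate P? id

  module _ {P Q : Pred (Fin n) 0ℓ} (P? : Decidable P) (Q? : Decidable Q) where

    count-cong : ∀[ P ⇒ Q ] → ∀[ Q ⇒ P ] → count P? ≡ count Q?
    count-cong P⇒Q Q⇒P = begin
      count P?             ≡⟨ count≡∑𝟙 P? ⟩
      ∑[ a < n ] 𝟙 (P? a)  ≡⟨ sum-cong-≗ (λ a → 𝟙-cong (P? a) (Q? a) P⇒Q Q⇒P) ⟩
      ∑[ a < n ] 𝟙 (Q? a)  ≡⟨ count≡∑𝟙 Q? ⟨
      count Q?             ∎

    count-< : ∀[ P ⇒ Q ] → ∀ {a} → Q a → ¬ P a → count P? < count Q?
    count-< P⇒Q {a} Qa ¬Pa = subst₂ _<_ (sym (count≡∑𝟙 P?)) (sym (count≡∑𝟙 Q?))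
      (sum-mono-< (λ b → 𝟙-mono (P? b) (Q? b) P⇒Q) a
        (subst₂ _<_ (sym (𝟙-no (P? a) ¬Pa)) (sym (𝟙-yes (Q? a) Qa)) ≤-refl))

  module _ {P : Pred (Fin n) 0ℓ} (P? : Decidable P) where

    count-all : (∀ a → P a) → count P? ≡ n
    count-all ∀P = trans (cong length (filter-all P? (All.universal ∀P (allFin n)))) (length-tabulate id)

    count-pos : ∀ {a} → P a → 0 < count P?
    count-pos {a} Pa = subst (0 <_) (sym (count≡∑𝟙 P?))
      (<-≤-trans (subst (0 <_) (sym (𝟙-yes (P? a) Pa)) z<s) (≤-sum (λ b → 𝟙 (P? b)) a))

    count-single : ∀ {a} → P a → (∀ {b} → P b → b ≡ a) → count P? ≡ 1
    count-single {a} Pa unique = begin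
      count P?             ≡⟨ count≡∑𝟙 P? ⟩
      ∑[ b < n ] 𝟙 (P? b)  ≡⟨ sum-supported-at (λ b → 𝟙 (P? b)) a (λ b b≢a → 𝟙-no (P? b) (b≢a ∘ unique)) ⟩
      𝟙 (P? a)             ≡⟨ 𝟙-yes (P? a) Pa ⟩
      1                    ∎

    count-permute : (π : Permutation n n) → count (P? ∘ (π ⟨$⟩ʳ_)) ≡ count P?
    count-permute π = begin
      count (P? ∘ (π ⟨$⟩ʳ_))        ≡⟨ count≡∑𝟙 (P? ∘ (π ⟨$⟩ʳ_)) ⟩
      ∑[ a < n ] 𝟙 (P? (π ⟨$⟩ʳ a))  ≡⟨ ∑-permute (λ b → 𝟙 (P? b)) π ⟨
      ∑[ b < n ] 𝟙 (P? b)           ≡⟨ count≡∑𝟙 P? ⟨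
      count P?                      ∎

  card : Subset n → ℕ
  card X = count (_∈? X)

  card-∪ : ∀ {X Y : Subset n} → (∀ {a} → a ∈ X → a ∉ Y) → card (X ∪ Y) ≡ card X + card Y
  card-∪ {X} {Y} disjoint = begin
    card (X ∪ Y)                                   ≡⟨ count≡∑𝟙 (_∈? X ∪ Y) ⟩
    ∑[ a < n ] 𝟙 (a ∈? X ∪ Y)                      ≡⟨ sum-cong-≗ 𝟙-∪ ⟩
    ∑[ a < n ] (𝟙 (a ∈? X) + 𝟙 (a ∈? Y))           ≡⟨ ∑-distrib-+ (λ a → 𝟙 (a ∈? X)) (λ a → 𝟙 (a ∈? Y)) ⟩
    ∑[ a < n ] 𝟙 (a ∈? X) + ∑[ a < n ] 𝟙 (a ∈? Y)  ≡⟨ cong₂ _+_ (count≡∑𝟙 (_∈? X)) (count≡∑𝟙 (_∈? Y)) ⟨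
    card X + card Y                                ∎
    where
    𝟙-∪ : ∀ a → 𝟙 (a ∈? X ∪ Y) ≡ 𝟙 (a ∈? X) + 𝟙 (a ∈? Y)
    𝟙-∪ a with a ∈? X | a ∈? Y | a ∈? X ∪ Y
    ... | yes a∈X | yes a∈Y | _          = contradiction a∈Y (disjoint a∈X)
    ... | yes _   | no _    | yes _      = refl
    ... | no _    | yes _   | yes _      = refl
    ... | no a∉X  | no a∉Y  | yes a∈X∪Y  = ⊥-elim ([ a∉X , a∉Y ]′ (x∈p∪q⁻ X Y a∈X∪Y))
    ... | yes a∈X | no _    | no a∉X∪Y   = contradiction (x∈p∪q⁺ (inj₁ a∈X)) a∉X∪Y
    ... | no _    | yes a∈Y | no a∉X∪Y   = contradiction (x∈p∪q⁺ (inj₂ a∈Y)) a∉X∪Y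
    ... | no _    | no _    | no _       = refl

  card-S₀ : ∀ {S : Subset n} → 𝟎 ∉ S → card (S₀ S) ≡ suc (card S)
  card-S₀ {S} 𝟎∉S = begin
    card (S ∪ ⁅ 𝟎 ⁆)     ≡⟨ card-∪ (λ a∈S a∈⁅𝟎⁆ → 𝟎∉S (subst (_∈ S) (x∈⁅y⁆⇒x≡y 𝟎 a∈⁅𝟎⁆) a∈S)) ⟩
    card S + card ⁅ 𝟎 ⁆  ≡⟨ cong (card S +_) (count-single (_∈? ⁅ 𝟎 ⁆) (x∈⁅x⁆ 𝟎) (x∈⁅y⁆⇒x≡y 𝟎)) ⟩
    card S + 1           ≡⟨ +-comm (card S) 1 ⟩
    suc (card S)         ∎

  degree≡card : ∀ S x → degree S x ≡ card S
  degree≡card S x = count-permute (_∈? S) (reflection x)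

  𝟎∈S₀ : ∀ {S : Subset n} → 𝟎 ∈ S₀ S
  𝟎∈S₀ = x∈p∪q⁺ (inj₂ (x∈⁅x⁆ 𝟎))

  card-S₀≡suc-degree : ∀ {S : Subset n} → 𝟎 ∉ S → ∀ x → card (S₀ S) ≡ suc (degree S x)
  card-S₀≡suc-degree {S} 𝟎∉S x = trans (card-S₀ 𝟎∉S) (cong suc (sym (degree≡card S x)))

  -- Cosets of a subgroup

  inQuot? : (K X : Subset n) → Decidable (InQuot K X)
  inQuot? K X a = any? (λ y → (y ∈? X) ×-dec ((a ⊖ y) ∈? K))

  UnionOfCosets : Subset n → Subset n → Set
  UnionOfCosets K X = ∀ a → InQuot K X a → a ∈ X

  subgroup⇒unionOfCosets : ∀ {K H : Subset n} → IsSubgroup H → K ⊆ H → UnionOfCosets K H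
  subgroup⇒unionOfCosets {H = H} (_ , ⊕-closed , _) K⊆H a (y , y∈H , a⊖y∈K) =
    subst (_∈ H) (//-rightDividesˡ y a) (⊕-closed _ _ (K⊆H a⊖y∈K) y∈H)

  module Coset {K : Subset n} (K-subgroup : IsSubgroup K) where

    private
      𝟎∈K : 𝟎 ∈ K
      𝟎∈K = proj₁ K-subgroup

      ⊕-closed : ∀ a b → a ∈ K → b ∈ K → (a ⊕ b) ∈ K
      ⊕-closed = proj₁ (proj₂ K-subgroup)

      ⊝-closed : ∀ a → a ∈ K → (⊝ a) ∈ K
      ⊝-closed = proj₂ (proj₂ K-subgroup)

    -- _⊖_ computes, so the points of a ~ b cannot be inferred and are often passed explicitly.
    infix 4 _~_
    _~_ : Fin n → Fin n → Set
    a ~ b = (a ⊖ b) ∈ K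

    ~-refl : ∀ a → a ~ a
    ~-refl a = subst (_∈ K) (sym (⊕-inverseʳ a)) 𝟎∈K

    ~-sym : ∀ {a b} → a ~ b → b ~ a
    ~-sym {a} {b} a~b = subst (_∈ K) (⁻¹-anti-homo‿- a b) (⊝-closed _ a~b)

    ~-trans : ∀ {a b c} → a ~ b → b ~ c → a ~ c
    ~-trans {a} {b} {c} a~b b~c = subst (_∈ K) (⊖-telescope a b c) (⊕-closed _ _ a~b b~c)

    InQuot-resp : ∀ {X a b} → a ~ b → InQuot K X b → InQuot K X a
    InQuot-resp {a = a} {b} a~b (y , y∈X , b~y) = y , y∈X , ~-trans {a} {b} {y} a~b b~y

    private
      least-in-coset : ∀ a → ∃[ r ] r ~ a × (∀ b → b ~ a → toℕ r ≤ toℕ b)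
      least-in-coset a = least (λ b → (b ⊖ a) ∈? K) {a} (~-refl a)

    rep : Fin n → Fin n
    rep a = proj₁ (least-in-coset a)

    rep~ : ∀ a → rep a ~ a
    rep~ a = proj₁ (proj₂ (least-in-coset a))

    rep-cosetRep : ∀ a → CosetRep K (rep a)
    rep-cosetRep a b b~rep = proj₂ (proj₂ (least-in-coset a)) b (~-trans {b} {rep a} {a} b~rep (rep~ a))

    ~rep : ∀ a → a ~ rep a
    ~rep a = ~-sym {rep a} {a} (rep~ a)

    cosetRep-unique : ∀ {r s} → CosetRep K r → CosetRep K s → r ~ s → r ≡ s
    cosetRep-unique {r} {s} r-least s-least r~s =
      toℕ-injective (≤-antisym (r-least s (~-sym {r} {s} r~s)) (s-least r r~s))

    ~⇒rep≡ : ∀ {a b} → a ~ b → rep a ≡ rep b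
    ~⇒rep≡ {a} {b} a~b = cosetRep-unique (rep-cosetRep a) (rep-cosetRep b)
      (~-trans {rep a} {a} {rep b} (rep~ a) (~-trans {a} {b} {rep b} a~b (~rep b)))

    rep≡⇒~ : ∀ {a b} → rep a ≡ rep b → a ~ b
    rep≡⇒~ {a} {b} rep-a≡rep-b = ~-trans {a} {rep a} {b} (~rep a) (subst (_~ b) (sym rep-a≡rep-b) (rep~ b))

    count-InQuot : ∀ X → count (inQuot? K X) ≡ ∣ X / K ∣ * card K
    count-InQuot X = begin
      count (inQuot? K X)                            ≡⟨ count≡∑𝟙 (inQuot? K X) ⟩
      ∑[ a < n ] 𝟙 (inQuot? K X a)                   ≡⟨ sum-cong-≗ 𝟙-InQuot ⟩
      ∑[ a < n ] ∑[ r < n ] (𝟙 (R? r) * 𝟙 (a ~? r))  ≡⟨ ∑-comm (λ a r → 𝟙 (R? r) * 𝟙 (a ~? r)) ⟩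
      ∑[ r < n ] ∑[ a < n ] (𝟙 (R? r) * 𝟙 (a ~? r))  ≡⟨ sum-cong-≗ (λ r → *-distribˡ-sum (𝟙 (R? r)) (λ a → 𝟙 (a ~? r))) ⟨
      ∑[ r < n ] (𝟙 (R? r) * ∑[ a < n ] 𝟙 (a ~? r))  ≡⟨ sum-cong-≗ (λ r → cong (𝟙 (R? r) *_) (coset-size r)) ⟩
      ∑[ r < n ] (𝟙 (R? r) * card K)                 ≡⟨ *-distribʳ-sum (card K) (λ r → 𝟙 (R? r)) ⟨
      (∑[ r < n ] 𝟙 (R? r)) * card K                 ≡⟨ cong (_* card K) (count≡∑𝟙 R?) ⟨
      ∣ X / K ∣ * card K                             ∎
      where
      R? : Decidable (λ r → CosetRep K r × InQuot K X r)
      R? = cosetRep? K X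

      _~?_ : ∀ a b → Dec (a ~ b)
      a ~? b = (a ⊖ b) ∈? K

      coset-size : ∀ r → ∑[ a < n ] 𝟙 (a ~? r) ≡ card K
      coset-size r = trans (sym (count≡∑𝟙 (λ a → a ~? r))) (count-permute (_∈? K) (translation r))

      𝟙-InQuot : ∀ a → 𝟙 (inQuot? K X a) ≡ ∑[ r < n ] (𝟙 (R? r) * 𝟙 (a ~? r))
      𝟙-InQuot a = sym (begin
        ∑[ r < n ] (𝟙 (R? r) * 𝟙 (a ~? r))  ≡⟨ sum-supported-at (λ r → 𝟙 (R? r) * 𝟙 (a ~? r)) (rep a) off-rep ⟩
        𝟙 (R? (rep a)) * 𝟙 (a ~? rep a)     ≡⟨ cong (𝟙 (R? (rep a)) *_) (𝟙-yes (a ~? rep a) (~rep a)) ⟩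
        𝟙 (R? (rep a)) * 1                  ≡⟨ *-identityʳ _ ⟩
        𝟙 (R? (rep a))                      ≡⟨ 𝟙-cong (R? (rep a)) (inQuot? K X a) (InQuot-resp {X} {a} {rep a} (~rep a) ∘ proj₂)
                                                    (λ a∈X+K → rep-cosetRep a , InQuot-resp {X} {rep a} {a} (rep~ a) a∈X+K) ⟩
        𝟙 (inQuot? K X a)                 ∎)
        where
        off-rep : ∀ r → r ≢ rep a → 𝟙 (R? r) * 𝟙 (a ~? r) ≡ 0
        off-rep r r≢rep = trans (𝟙-* (R? r) (a ~? r)) (𝟙-no (R? r ×-dec (a ~? r)) λ ((r-least , _) , a~r) →
          r≢rep (cosetRep-unique r-least (rep-cosetRep a) (~-trans {r} {a} {rep a} (~-sym {a} {r} a~r) (~rep a))))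

    0<card : 0 < card K
    0<card = count-pos (_∈? K) 𝟎∈K

    card≡∣X/K∣*card : ∀ {X} → UnionOfCosets K X → card X ≡ ∣ X / K ∣ * card K
    card≡∣X/K∣*card {X} X+K⊆X =
      trans (count-cong (_∈? X) (inQuot? K X) (λ {a} a∈X → a , a∈X , ~-refl a) (X+K⊆X _)) (count-InQuot X)

    lagrange : ∀ {H} → IsSubgroup H → K ⊆ H → card H ≡ ∣ H / K ∣ * card K
    lagrange H-subgroup K⊆H = card≡∣X/K∣*card (subgroup⇒unionOfCosets H-subgroup K⊆H)

    1≤∣X/K∣ : ∀ {X a} → a ∈ X → 1 ≤ ∣ X / K ∣
    1≤∣X/K∣ {X} {a} a∈X = count-pos (cosetRep? K X) (rep-cosetRep a , a , a∈X , rep~ a)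

    2≤∣H/K∣ : ∀ {H a} → IsSubgroup H → K ⊆ H → a ∈ H → a ∉ K → 2 ≤ ∣ H / K ∣
    2≤∣H/K∣ {H} H-subgroup K⊆H a∈H a∉K =
      n<m*n⇒1<m ∣ H / K ∣ (subst (card K <_) (lagrange H-subgroup K⊆H) (count-< (_∈? K) (_∈? H) K⊆H a∈H a∉K))

    ∣X/K∣≡∣⊤/K∣⇒cover : ∀ {X} → ∣ X / K ∣ ≡ ∣ ⊤ / K ∣ → ∀ a → InQuot K X a
    ∣X/K∣≡∣⊤/K∣⇒cover {X} ∣X/K∣≡∣⊤/K∣ a with inQuot? K X a
    ... | yes a∈X+K = a∈X+K
    ... | no a∉X+K  = contradiction same-count (<⇒≢ (count-< (inQuot? K X) (inQuot? K ⊤)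
                        (λ (y , _ , a~y) → y , ∈⊤ , a~y) {a} (a , ∈⊤ , ~-refl a) a∉X+K))
      where
      same-count : count (inQuot? K X) ≡ count (inQuot? K ⊤)
      same-count = trans (count-InQuot X) (trans (cong (_* card K) ∣X/K∣≡∣⊤/K∣) (sym (count-InQuot ⊤)))

    private
      reps : List (Fin n)
      reps = filter (cosetRep? K ⊤) (allFin n)

      reps-unique : Unique reps
      reps-unique = Unique.filter⁺ (cosetRep? K ⊤) (Unique.allFin⁺ n)

      rep∈reps : ∀ a → rep a ∈ₗ reps
      rep∈reps a = ∈-filter⁺ (cosetRep? K ⊤) (∈-allFin (rep a)) (rep-cosetRep a , rep a , ∈⊤ , ~-refl (rep a))

    cosetIndex : Fin n → Fin ∣ ⊤ / K ∣
    cosetIndex a = index (rep∈reps a)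

    private
      lookup-cosetIndex : ∀ a → lookup reps (cosetIndex a) ≡ rep a
      lookup-cosetIndex a = sym (lookup-index (rep∈reps a))

      cosetIndex≡⇒rep≡ : ∀ {a b} → cosetIndex a ≡ cosetIndex b → rep a ≡ rep b
      cosetIndex≡⇒rep≡ {a} {b} eq = trans (sym (lookup-cosetIndex a)) (trans (cong (lookup reps) eq) (lookup-cosetIndex b))

      rep≡⇒cosetIndex≡ : ∀ {a b} → rep a ≡ rep b → cosetIndex a ≡ cosetIndex b
      rep≡⇒cosetIndex≡ {a} {b} eq = lookup-injective reps-unique (trans (lookup-cosetIndex a) (trans eq (sym (lookup-cosetIndex b))))

    cosetIndex-≡⇔~ : ∀ a b → (cosetIndex a ≡ cosetIndex b) ⇔ (a ~ b)
    cosetIndex-≡⇔~ a b =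
      mk⇔ (rep≡⇒~ {a} {b} ∘ cosetIndex≡⇒rep≡ {a} {b}) (rep≡⇒cosetIndex≡ {a} {b} ∘ ~⇒rep≡ {a} {b})

    cosetIndex-surjective : ∀ j → ∃ λ a → cosetIndex a ≡ j
    cosetIndex-surjective j = r , lookup-injective reps-unique (trans (lookup-cosetIndex r) rep-r≡r)
      where
      r : Fin n
      r = lookup reps j

      r-cosetRep : CosetRep K r
      r-cosetRep = proj₁ (proj₂ (∈-filter⁻ (cosetRep? K ⊤) {xs = allFin n} (∈-lookup j)))

      rep-r≡r : rep r ≡ r
      rep-r≡r = cosetRep-unique (rep-cosetRep r) r-cosetRep (rep~ r)

    quotAdj⇔≢ : ∀ {X} → (∀ a → InQuot K X a) → ∀ a b → QuotAdj K X a b ⇔ (cosetIndex a ≢ cosetIndex b)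
    quotAdj⇔≢ {X} X+K≡ℤₙ a b = mk⇔ to from
      where
      to : QuotAdj K X a b → cosetIndex a ≢ cosetIndex b
      to (_ , a≁b) = a≁b ∘ Equivalence.to (cosetIndex-≡⇔~ a b)
      from : cosetIndex a ≢ cosetIndex b → QuotAdj K X a b
      from ≢ = X+K≡ℤₙ (a ⊖ b) , ≢ ∘ Equivalence.from (cosetIndex-≡⇔~ a b)

    quotCayleyIsoComplete : ∀ {X} → (∀ a → InQuot K X a) → QuotCayleyIsoComplete K X ∣ ⊤ / K ∣
    quotCayleyIsoComplete X+K≡ℤₙ = cosetIndex , cosetIndex-≡⇔~ , cosetIndex-surjective , quotAdj⇔≢ X+K≡ℤₙ

  full⇒∣X/K∣≡1 : ∀ {X K : Subset n} → 𝟎 ∈ X → (∀ a → a ∈ K) → ∣ X / K ∣ ≡ 1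
  full⇒∣X/K∣≡1 {X} {K} 𝟎∈X ∀∈K = count-single (cosetRep? K X) {𝟎} ((λ _ _ → z≤n) , 𝟎 , 𝟎∈X , ∀∈K _)
    (λ {b} (b-least , _) → toℕ-injective (n≤0⇒n≡0 (b-least 𝟎 (∀∈K _))))

  periods⇒unionOfCosets : ∀ {K X : Subset n} → (∀ a → a ∈ K → a ≡ 𝟎 ⊎ Period X a) → UnionOfCosets K X
  periods⇒unionOfCosets {X = X} K-periods a (y , y∈X , a⊖y∈K) with K-periods (a ⊖ y) a⊖y∈K
  ... | inj₁ a⊖y≡𝟎       = subst (_∈ X) (sym (x∙y⁻¹≈ε⇒x≈y a y a⊖y≡𝟎)) y∈X
  ... | inj₂ (_ , X+a⊖y) = subst (_∈ X) (x⊕[y⊖x]≡y y a) (Equivalence.to (X+a⊖y y) y∈X)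

  quotPeriodicWith⇒⊆ : ∀ {K H X : Subset n} → QuotPeriodicWith K H X → K ⊆ H
  quotPeriodicWith⇒⊆ (_ , periods) {a} a∈K = Equivalence.to (periods a) (inj₁ a∈K)

  ∣X/K∣≡∣X/H∣*∣H/K∣ : ∀ {K H X : Subset n} → IsSubgroup K → IsSubgroup H → QuotPeriodicWith K H X →
                      ∣ X / K ∣ ≡ ∣ X / H ∣ * ∣ H / K ∣
  ∣X/K∣≡∣X/H∣*∣H/K∣ {K} {H} {X} K-subgroup H-subgroup X/K-periodic =
    *-cancelʳ-≡ ∣ X / K ∣ (∣ X / H ∣ * ∣ H / K ∣) (card K) {{>-nonZero K.0<card}} (begin
      ∣ X / K ∣ * card K                ≡⟨ K.count-InQuot X ⟨
      count (inQuot? K X)               ≡⟨ count-cong (inQuot? K X) (inQuot? H X) (λ {a} → X+K⊆X+H {a}) (λ {a} → X+H⊆X+K {a}) ⟩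
      count (inQuot? H X)               ≡⟨ H.count-InQuot X ⟩
      ∣ X / H ∣ * card H                ≡⟨ cong (∣ X / H ∣ *_) (K.lagrange H-subgroup K⊆H) ⟩
      ∣ X / H ∣ * (∣ H / K ∣ * card K)  ≡⟨ *-assoc ∣ X / H ∣ ∣ H / K ∣ (card K) ⟨
      ∣ X / H ∣ * ∣ H / K ∣ * card K    ∎)
    where
    module K = Coset K-subgroup
    module H = Coset H-subgroup

    K⊆H : K ⊆ H
    K⊆H = quotPeriodicWith⇒⊆ X/K-periodic

    X+K⊆X+H : ∀ {a} → InQuot K X a → InQuot H X a
    X+K⊆X+H (y , y∈X , a⊖y∈K) = y , y∈X , K⊆H a⊖y∈K

    X+H⊆X+K : ∀ {a} → InQuot H X a → InQuot K X a
    X+H⊆X+K {a} (y , y∈X , a⊖y∈H) with Equivalence.from (proj₂ X/K-periodic (a ⊖ y)) a⊖y∈H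
    ... | inj₁ a⊖y∈K           = y , y∈X , a⊖y∈K
    ... | inj₂ (_ , X+K+a⊖y)   =
      subst (InQuot K X) (x⊕[y⊖x]≡y y a) (Equivalence.to (X+K+a⊖y y) (y , y∈X , K.~-refl y))

  card≡1 : ∀ {K : Subset n} → 𝟎 ∈ K → Trivial K → card K ≡ 1
  card≡1 {K} 𝟎∈K trivial = count-single (_∈? K) 𝟎∈K (trivial _)

  nonTrivial⇒nonzero : ∀ {K : Subset n} → ¬ Trivial K → ∃ λ a → a ∈ K × a ≢ 𝟎
  nonTrivial⇒nonzero {K} nonTrivial with ¬∀⟶∃¬ n _ (λ a → (a ∈? K) →-dec (a ≟ᶠ 𝟎)) nonTrivial
  ... | a , ¬[a∈K→a≡𝟎] with a ∈? K
  ...   | yes a∈K = a , a∈K , ¬[a∈K→a≡𝟎] ∘ const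
  ...   | no a∉K  = contradiction (λ a∈K → contradiction a∈K a∉K) ¬[a∈K→a≡𝟎]

  1<card : ∀ {K : Subset n} → 𝟎 ∈ K → ¬ Trivial K → 1 < card K
  1<card {K} 𝟎∈K nonTrivial with nonTrivial⇒nonzero nonTrivial
  ... | a , a∈K , a≢𝟎 = subst (_< card K) (count-single (_≟ᶠ 𝟎) refl id)
                          (count-< (_≟ᶠ 𝟎) (_∈? K) (λ { refl → 𝟎∈K }) a∈K a≢𝟎)

  periodicWith⇒periodic : ∀ {K X : Subset n} → PeriodicWith K X → Periodic X
  periodicWith⇒periodic (nonTrivial , periods) with nonTrivial⇒nonzero nonTrivial
  ... | a , a∈K , a≢𝟎 with Equivalence.from (periods a) a∈K
  ...   | inj₁ a≡𝟎     = contradiction a≡𝟎 a≢𝟎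
  ...   | inj₂ a-period = a , a-period

  module _ {K X : Subset n} (𝟎∈K : 𝟎 ∈ K) where

    aperiodic⇒card≡1 : (Trivial K × Aperiodic X) ⊎ PeriodicWith K X → Aperiodic X → card K ≡ 1
    aperiodic⇒card≡1 (inj₁ (trivial , _)) _         = card≡1 𝟎∈K trivial
    aperiodic⇒card≡1 (inj₂ K-periodic)    aperiodic =
      let a , period = periodicWith⇒periodic K-periodic in contradiction period (aperiodic a)

    periodic⇒1<card : (Trivial K × Aperiodic X) ⊎ PeriodicWith K X → Periodic X → 1 < card K
    periodic⇒1<card (inj₁ (_ , aperiodic))   (a , period) = contradiction period (aperiodic a)
    periodic⇒1<card (inj₂ (nonTrivial , _)) _            = 1<card 𝟎∈K nonTrivial

  base⇒unionOfCosets : ∀ {K X : Subset n} → (Trivial K × Aperiodic X) ⊎ PeriodicWith K X → UnionOfCosets K X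
  base⇒unionOfCosets (inj₁ (trivial , _)) = periods⇒unionOfCosets (λ a a∈K → inj₁ (trivial a a∈K))
  base⇒unionOfCosets (inj₂ (_ , periods)) = periods⇒unionOfCosets (λ a → Equivalence.from (periods a))

  -- Indices along a subgroup series

  module Series {t : ℕ} {H : ℕ → Subset n}
    (H-subgroup : ∀ i → i ≤ 2 * t → IsSubgroup (H i))
    (H-⊆ : ∀ i → i < 2 * t → H i ⊆ H (suc i)) where

    evenIndex oddIndex : ℕ → ℕ
    evenIndex i = ∣ H (2 * i) / H (2 * i ∸ 1) ∣
    oddIndex  i = ∣ H (2 * i ∸ 1) / H (2 * i ∸ 2) ∣

    private
      H[2i∸d]-subgroup : ∀ {i} d → i ≤ t → IsSubgroup (H (2 * i ∸ d))
      H[2i∸d]-subgroup {i} d i≤t = H-subgroup (2 * i ∸ d) (≤-trans (m∸n≤m (2 * i) d) (*-monoʳ-≤ 2 i≤t))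

      module Step {j} (j<t : j < t) where

        H₂ⱼ H₂ⱼ₊₁ H₂ⱼ₊₂ : Subset n
        H₂ⱼ   = H (2 * j)
        H₂ⱼ₊₁ = H (suc (2 * j))
        H₂ⱼ₊₂ = H (2 + 2 * j)

        2+2j≤2t : 2 + 2 * j ≤ 2 * t
        2+2j≤2t = subst (_≤ 2 * t) (*-suc 2 j) (*-monoʳ-≤ 2 j<t)

        H₂ⱼ-subgroup : IsSubgroup H₂ⱼ
        H₂ⱼ-subgroup = H-subgroup (2 * j) (≤-trans (m≤n+m (2 * j) 2) 2+2j≤2t)

        H₂ⱼ₊₁-subgroup : IsSubgroup H₂ⱼ₊₁
        H₂ⱼ₊₁-subgroup = H-subgroup (suc (2 * j)) (≤-trans (n≤1+n _) 2+2j≤2t)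

        H₂ⱼ₊₂-subgroup : IsSubgroup H₂ⱼ₊₂
        H₂ⱼ₊₂-subgroup = H-subgroup (2 + 2 * j) 2+2j≤2t

        H₂ⱼ⊆H₂ⱼ₊₁ : H₂ⱼ ⊆ H₂ⱼ₊₁
        H₂ⱼ⊆H₂ⱼ₊₁ = H-⊆ (2 * j) (≤-trans (n≤1+n _) 2+2j≤2t)

        H₂ⱼ₊₁⊆H₂ⱼ₊₂ : H₂ⱼ₊₁ ⊆ H₂ⱼ₊₂
        H₂ⱼ₊₁⊆H₂ⱼ₊₂ = H-⊆ (suc (2 * j)) 2+2j≤2t

        evenIndex≡ : evenIndex (suc j) ≡ ∣ H₂ⱼ₊₂ / H₂ⱼ₊₁ ∣
        evenIndex≡ = cong (λ i → ∣ H i / H (i ∸ 1) ∣) (*-suc 2 j)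

        oddIndex≡ : oddIndex (suc j) ≡ ∣ H₂ⱼ₊₁ / H₂ⱼ ∣
        oddIndex≡ = cong (λ i → ∣ H (i ∸ 1) / H (i ∸ 2) ∣) (*-suc 2 j)

    card-H₂ₜ : card (H (2 * t)) ≡ prodTo evenIndex t * prodTo oddIndex t * card (H 0)
    card-H₂ₜ = begin
      card (H (2 * t))                                        ≡⟨ prodTo-telescope (λ j → card (H (2 * j))) _ t card-step ⟩
      prodTo (λ i → evenIndex i * oddIndex i) t * card (H 0)  ≡⟨ cong (_* card (H 0)) (prodTo-distrib-* evenIndex oddIndex t) ⟩
      prodTo evenIndex t * prodTo oddIndex t * card (H 0)     ∎
      where
      card-step : ∀ {j} → j < t → card (H (2 * suc j)) ≡ evenIndex (suc j) * oddIndex (suc j) * card (H (2 * j))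
      card-step {j} j<t = begin
        card (H (2 * suc j))                              ≡⟨ cong (card ∘ H) (*-suc 2 j) ⟩
        card H₂ⱼ₊₂                                        ≡⟨ Coset.lagrange H₂ⱼ₊₁-subgroup H₂ⱼ₊₂-subgroup H₂ⱼ₊₁⊆H₂ⱼ₊₂ ⟩
        ∣ H₂ⱼ₊₂ / H₂ⱼ₊₁ ∣ * card H₂ⱼ₊₁                    ≡⟨ cong (∣ H₂ⱼ₊₂ / H₂ⱼ₊₁ ∣ *_) card-H₂ⱼ₊₁ ⟩
        ∣ H₂ⱼ₊₂ / H₂ⱼ₊₁ ∣ * (∣ H₂ⱼ₊₁ / H₂ⱼ ∣ * card H₂ⱼ)  ≡⟨ *-assoc ∣ H₂ⱼ₊₂ / H₂ⱼ₊₁ ∣ ∣ H₂ⱼ₊₁ / H₂ⱼ ∣ (card H₂ⱼ) ⟨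
        ∣ H₂ⱼ₊₂ / H₂ⱼ₊₁ ∣ * ∣ H₂ⱼ₊₁ / H₂ⱼ ∣ * card H₂ⱼ    ≡⟨ cong₂ (λ u v → u * v * card H₂ⱼ) evenIndex≡ oddIndex≡ ⟨
        evenIndex (suc j) * oddIndex (suc j) * card H₂ⱼ   ∎
        where
        open Step j<t

        card-H₂ⱼ₊₁ : card H₂ⱼ₊₁ ≡ ∣ H₂ⱼ₊₁ / H₂ⱼ ∣ * card H₂ⱼ
        card-H₂ⱼ₊₁ = Coset.lagrange H₂ⱼ-subgroup H₂ⱼ₊₁-subgroup H₂ⱼ⊆H₂ⱼ₊₁

    2≤evenIndex : ∀ {X i} → i ≤ t → QuotPeriodicWith (H (2 * i ∸ 1)) (H (2 * i)) X → 2 ≤ evenIndex i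
    2≤evenIndex i≤t X/K-periodic@((a , a∈H , a∉K) , _) =
      Coset.2≤∣H/K∣ (H[2i∸d]-subgroup 1 i≤t) (H[2i∸d]-subgroup 0 i≤t) K⊆H a∈H a∉K
      where
      K⊆H = quotPeriodicWith⇒⊆ X/K-periodic

    1≤oddIndex : ∀ {i} → i ≤ t → 1 ≤ oddIndex i
    1≤oddIndex i≤t = Coset.1≤∣X/K∣ (H[2i∸d]-subgroup 2 i≤t) (proj₁ (H[2i∸d]-subgroup 1 i≤t))

    module _ {X : Subset n}
      (X-periodic : ∀ i → 1 ≤ i → i ≤ t → QuotPeriodicWith (H (2 * i ∸ 1)) (H (2 * i)) X)
      (same-size : ∀ i → i < t → ∣ X / H (2 * i) ∣ ≡ ∣ X / H (suc (2 * i)) ∣)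
      (H₂ₜ≡ℤₙ : H (2 * t) ≡ ⊤) where

      ∣X/H₀∣≡∏evenIndex : 𝟎 ∈ X → ∣ X / H 0 ∣ ≡ prodTo evenIndex t
      ∣X/H₀∣≡∏evenIndex 𝟎∈X = begin
        ∣ X / H 0 ∣                             ≡⟨ prodTo-telescope⁻ (λ j → ∣ X / H (2 * j) ∣) evenIndex t quotient-step ⟩
        ∣ X / H (2 * t) ∣ * prodTo evenIndex t  ≡⟨ cong (_* prodTo evenIndex t) (full⇒∣X/K∣≡1 𝟎∈X H₂ₜ-full) ⟩
        1 * prodTo evenIndex t                  ≡⟨ *-identityˡ (prodTo evenIndex t) ⟩
        prodTo evenIndex t                      ∎
        where
        H₂ₜ-full : ∀ a → a ∈ H (2 * t)
        H₂ₜ-full a = subst (a ∈_) (sym H₂ₜ≡ℤₙ) ∈⊤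

        quotient-step : ∀ {j} → j < t → ∣ X / H (2 * j) ∣ ≡ ∣ X / H (2 * suc j) ∣ * evenIndex (suc j)
        quotient-step {j} j<t = begin
          ∣ X / H₂ⱼ ∣                                ≡⟨ same-size j j<t ⟩
          ∣ X / H₂ⱼ₊₁ ∣                              ≡⟨ ∣X/K∣≡∣X/H∣*∣H/K∣ H₂ⱼ₊₁-subgroup H₂ⱼ₊₂-subgroup X/H₂ⱼ₊₁-periodic ⟩
          ∣ X / H₂ⱼ₊₂ ∣ * ∣ H₂ⱼ₊₂ / H₂ⱼ₊₁ ∣          ≡⟨ cong₂ _*_ (cong (λ i → ∣ X / H i ∣) (*-suc 2 j)) evenIndex≡ ⟨
          ∣ X / H (2 * suc j) ∣ * evenIndex (suc j)  ∎
          where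
          open Step j<t

          X/H₂ⱼ₊₁-periodic : QuotPeriodicWith H₂ⱼ₊₁ H₂ⱼ₊₂ X
          X/H₂ⱼ₊₁-periodic = subst (λ i → QuotPeriodicWith (H (i ∸ 1)) (H i) X) (*-suc 2 j) (X-periodic (suc j) z<s j<t)

      card≡∏evenIndex*card-H₀ : 𝟎 ∈ X → UnionOfCosets (H 0) X → card X ≡ prodTo evenIndex t * card (H 0)
      card≡∏evenIndex*card-H₀ 𝟎∈X X+H₀⊆X = begin
        card X                           ≡⟨ Coset.card≡∣X/K∣*card (H-subgroup 0 z≤n) X+H₀⊆X ⟩
        ∣ X / H 0 ∣ * card (H 0)         ≡⟨ cong (_* card (H 0)) (∣X/H₀∣≡∏evenIndex 𝟎∈X) ⟩
        prodTo evenIndex t * card (H 0)  ∎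

      card*∏oddIndex≡n : 𝟎 ∈ X → UnionOfCosets (H 0) X → card X * prodTo oddIndex t ≡ n
      card*∏oddIndex≡n 𝟎∈X X+H₀⊆X = begin
        card X * prodTo oddIndex t                           ≡⟨ cong (_* prodTo oddIndex t) (card≡∏evenIndex*card-H₀ 𝟎∈X X+H₀⊆X) ⟩
        prodTo evenIndex t * card (H 0) * prodTo oddIndex t  ≡⟨ xy∙z≈xz∙y (prodTo evenIndex t) (card (H 0)) (prodTo oddIndex t) ⟩
        prodTo evenIndex t * prodTo oddIndex t * card (H 0)  ≡⟨ card-H₂ₜ ⟨
        card (H (2 * t))                                     ≡⟨ cong card H₂ₜ≡ℤₙ ⟩
        card ⊤                                               ≡⟨ count-all (_∈? ⊤) (λ _ → ∈⊤) ⟩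
        n                                                    ∎

    quotCayleyIsoComplete-H₂ₜ₋₁ : ∀ {X} → H (2 * t) ≡ ⊤ → ∣ X / H (2 * t ∸ 1) ∣ ≡ ∣ ⊤ / H (2 * t ∸ 1) ∣ →
                                  QuotCayleyIsoComplete (H (2 * t ∸ 1)) X (evenIndex t)
    quotCayleyIsoComplete-H₂ₜ₋₁ H₂ₜ≡ℤₙ same-size =
      subst (λ Y → QuotCayleyIsoComplete (H (2 * t ∸ 1)) _ ∣ Y / H (2 * t ∸ 1) ∣) (sym H₂ₜ≡ℤₙ)
            (Coset.quotCayleyIsoComplete K-subgroup (Coset.∣X/K∣≡∣⊤/K∣⇒cover K-subgroup same-size))
      where
      K-subgroup : IsSubgroup (H (2 * t ∸ 1))
      K-subgroup = H-subgroup (2 * t ∸ 1) (m∸n≤m (2 * t) 1)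

series-⊆ : ∀ {k t} {H : ℕ → Subset (suc k)} → (∀ i → suc i < 2 * t → H i ⊂ H (suc i)) →
           H (2 * t ∸ 1) ⊆ H (2 * t) → ∀ i → i < 2 * t → H i ⊆ H (suc i)
series-⊆ {H = H} H-⊂ H₂ₜ₋₁⊆H₂ₜ i i<2t with m≤n⇒m<n∨m≡n i<2t
... | inj₁ 1+i<2t = proj₁ (H-⊂ i 1+i<2t)
... | inj₂ 1+i≡2t = subst (λ j → H (j ∸ 1) ⊆ H j) (sym 1+i≡2t) H₂ₜ₋₁⊆H₂ₜ

lemma2p12 : (p ℓ m k : ℕ) → Prime p → 1 ≤ ℓ → 2 ≤ m → suc k ≡ p ^ ℓ * m →
    (S : Subset (suc k)) → IsConnectionSet S → Connected S →
    (∀ x → degree S x ≡ p ^ ℓ ∸ 1) → Pyramidal (S₀ S) →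
    (t : ℕ) (H : ℕ → Subset (suc k)) → Admissible (S₀ S) t H →
    Σ (ℕ → ℕ) λ ls → Σ (ℕ → ℕ) λ ms →
        (∀ i → 1 ≤ i → i ≤ t → 1 ≤ ls i × 1 ≤ ms i)
      × prodTo ms t ∣ m
      × (Aperiodic (S₀ S) → sumTo ls t ≡ ℓ)
      × (Periodic (S₀ S) → sumTo ls t < ℓ)
      × (∀ i → 1 ≤ i → i ≤ t →
           ∣ H (2 * i) / H (2 * i ∸ 1) ∣ ≡ p ^ ls i
         × ∣ H (2 * i ∸ 1) / H (2 * i ∸ 2) ∣ ≡ ms i)
      × QuotCayleyIsoComplete (H (2 * t ∸ 1)) (S₀ S) (p ^ ls t)
lemma2p12 p ℓ m k p-prime _ _ n≡p^ℓ*m S (𝟎∉S , _) _ regular _ t H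
          (1≤t , H-subgroup , H-⊂ , H₂ₜ₋₁⊆H₂ₜ , H₂ₜ≡ℤₙ , base , _ , X-periodic , T3-top , T3-steps) =
  ls , oddIndex , positive , ∣-reflexive ∏oddIndex≡m , aperiodic⇒∑ls≡ℓ , periodic⇒∑ls<ℓ ,
  (λ i 1≤i i≤t → a≡p^ls i 1≤i i≤t , refl) ,
  subst (QuotCayleyIsoComplete (H (2 * t ∸ 1)) (S₀ S)) (a≡p^ls t 1≤t ≤-refl)
        (quotCayleyIsoComplete-H₂ₜ₋₁ H₂ₜ≡ℤₙ T3-top)
  where
  open Series {t = t} {H} H-subgroup (series-⊆ {t = t} H-⊂ H₂ₜ₋₁⊆H₂ₜ)

  instance
    p≢0 : NonZero p
    p≢0 = prime⇒nonZero p-prime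

  𝟎∈H₀ : 𝟎 ∈ H 0
  𝟎∈H₀ = proj₁ (H-subgroup 0 z≤n)

  S₀+H₀⊆S₀ : UnionOfCosets (H 0) (S₀ S)
  S₀+H₀⊆S₀ = base⇒unionOfCosets base

  card-S₀≡p^ℓ : card (S₀ S) ≡ p ^ ℓ
  card-S₀≡p^ℓ = trans (card-S₀≡suc-degree 𝟎∉S 𝟎) (trans (cong suc (regular 𝟎)) (m+[n∸m]≡n (m^n>0 p ℓ)))

  ∏oddIndex≡m : prodTo oddIndex t ≡ m
  ∏oddIndex≡m = *-cancelˡ-≡ (prodTo oddIndex t) m (p ^ ℓ) {{m^n≢0 p ℓ}}
    (trans (cong (_* prodTo oddIndex t) (sym card-S₀≡p^ℓ))
           (trans (card*∏oddIndex≡n X-periodic T3-steps H₂ₜ≡ℤₙ 𝟎∈S₀ S₀+H₀⊆S₀) n≡p^ℓ*m))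

  ∏evenIndex*card-H₀≡p^ℓ : prodTo evenIndex t * card (H 0) ≡ p ^ ℓ
  ∏evenIndex*card-H₀≡p^ℓ = trans (sym (card≡∏evenIndex*card-H₀ X-periodic T3-steps H₂ₜ≡ℤₙ 𝟎∈S₀ S₀+H₀⊆S₀)) card-S₀≡p^ℓ

  open PowerFactorisation (prodTo*≡p^⇒powers p-prime t evenIndex (card (H 0)) ℓ ∏evenIndex*card-H₀≡p^ℓ)

  positive : ∀ i → 1 ≤ i → i ≤ t → 1 ≤ ls i × 1 ≤ oddIndex i
  positive i 1≤i i≤t =
    1<m^n⇒0<n (ls i) (subst (1 <_) (a≡p^ls i 1≤i i≤t) (2≤evenIndex i≤t (X-periodic i 1≤i i≤t))) , 1≤oddIndex i≤t

  aperiodic⇒∑ls≡ℓ : Aperiodic (S₀ S) → sumTo ls t ≡ ℓ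
  aperiodic⇒∑ls≡ℓ aperiodic = trans (sym (trans (cong (sumTo ls t +_) e≡0) (+-identityʳ (sumTo ls t)))) sumTo-ls+e≡ℓ
    where
    e≡0 : e ≡ 0
    e≡0 = ^-injectiveʳ (nonTrivial⇒n>1 p {{prime⇒nonTrivial p-prime}})
                       (trans (sym c≡p^e) (aperiodic⇒card≡1 𝟎∈H₀ base aperiodic))

  periodic⇒∑ls<ℓ : Periodic (S₀ S) → sumTo ls t < ℓ
  periodic⇒∑ls<ℓ periodic = subst (sumTo ls t <_) sumTo-ls+e≡ℓ
    (m<m+n (sumTo ls t) (1<m^n⇒0<n e (subst (1 <_) c≡p^e (periodic⇒1<card 𝟎∈H₀ base periodic))))
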